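{- Let $0<\varepsilon\le1$ and $q$ a non-negative integer. Let $\mathcal{F}_0,\dots,\mathcal{F}_q$ be uniformly density regular families and $n_0,\dots,n_q$ integers with $n_p\ge T\big((\mathcal{F}_s)_{s=0}^p,\varepsilon\big)$ for all $p=0,\dots,q$. Let $D$ be a subset of $\prod_{p=0}^q[n_p]$ of density at least $\varepsilon$. Then there exists a sequence $(I_p)_{p=0}^q$ such that (i) $I_p$ is an element of $\mathcal{F}_p$ contained in $[n_p]$ for all $p=0,\dots,q$, and (ii) $\prod_{p=0}^qI_p\subseteq D$.
   Context: $[n]=\{1,\dots,n\}$; density of $D$ in a finite set $X$ means $|D\cap X|/|X|$. A family $\mathcal{F}$ of nonempty finite subsets of the positive integers is uniformly density regular if for every $0<\varepsilon\le1$ there is an integer $n_0$ such that for every interval $I$ of positive integers of length at least $n_0$ and every $A\subseteq I$ with $|A|\ge\varepsilon|I|$, $A$ contains an element of $\mathcal{F}$; the least such $n_0$ is $B(\mathcal{F},\varepsilon)$. Let $M(\mathcal{F},\eta)=\max\{|\{F\in\mathcal{F}:F\subseteq I\}|: I \text{ an interval of length } B(\mathcal{F},\eta)\}$ and $\theta_2(\mathcal{F},\eta)=\frac{\eta}{4M(\mathcal{F},\eta/4)}$. For uniformly density regular $\mathcal{F}_0,\dots,\mathcal{F}_q$ and $\varepsilon>0$ define $\varepsilon_0=\varepsilon$, $\varepsilon_{p+1}=\theta_2(\mathcal{F}_p,\varepsilon_p)$ for $p<q$, and $T\big((\mathcal{F}_p)_{p=0}^q,\varepsilon\big)=\Big\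lceil\frac{2}{\varepsilon_q}B(\mathcal{F}_q,\varepsilon_q/4)\Big\rceil$.
   Formalization: The parameter ε, the density bound and the seed of the sequence ε_p, ranges over the rationals in (0,1] rather than over the reals. -}

module Defs where

open import Data.Nat as ℕ using (ℕ; zero; suc; _≤_; _<_)
open import Data.Integer as ℤ using (ℤ; +_)
open import Data.Rational as ℚ using (ℚ; 0ℚ; ceiling)
open import Data.Rational.Properties using (_≟_)
open import Data.Fin using (Fin; zero; suc; inject₁)
open import Data.Vec using (Vec; lookup)
open import Data.List using (List; []; length)
open import Data.List.Relation.Unary.All using (All)
open import Data.List.Relation.Unary.AllPairs using (AllPairs)
open import Data.List.Membership.Propositional using (_∈_)
open import Data.Product using (Σ; _×_; ∃)
open import Relation.Nullary using (¬_; yes; no)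
open import Relation.Binary.PropositionalEquality using (_≡_; _≢_)
open import Function.Bundles using (_⇔_)

⟦_⟧ : ℕ → ℚ
⟦ n ⟧ = (+ n) ℚ./ 1

-- division of rationals, with junk value 0 when dividing by 0
-- (only ever applied to nonzero divisors below)
_÷'_ : ℚ → ℚ → ℚ
p ÷' q with q ≟ 0ℚ
... | yes _ = 0ℚ
... | no q≢0 = ℚ._÷_ p q {{ℚ.≢-nonZero q≢0}}

-- A finite set of naturals is represented canonically by its
-- strictly increasing list of elements.
IsFinSet : List ℕ → Set
IsFinSet xs = AllPairs _<_ xs

InInterval : ℕ → ℕ → ℕ → Set
InInterval a L x = a ≤ x × x < a ℕ.+ L

In[_] : ℕ → ℕ → Set
In[ n ] x = 1 ≤ x × x ≤ n

record Family : Set₁ where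
  field
    mem      : List ℕ → Set
    mem-set  : ∀ {S} → mem S → IsFinSet S
    mem-ne   : ∀ {S} → mem S → S ≢ []
    mem-pos  : ∀ {S} → mem S → All (1 ≤_) S
open Family public

ContainsElem : Family → List ℕ → Set
ContainsElem F A = ∃ λ S → mem F S × All (_∈ A) S

Good : Family → ℚ → ℕ → Set
Good F η n0 = ∀ (a L : ℕ) → 1 ≤ a → n0 ≤ L →
  ∀ (A : List ℕ) → IsFinSet A → All (InInterval a L) A →
  η ℚ.* ⟦ L ⟧ ℚ.≤ ⟦ length A ⟧ → ContainsElem F A

UniformlyDensityRegular : Family → Set
UniformlyDensityRegular F =
  ∀ (η : ℚ) → 0ℚ ℚ.< η → η ℚ.≤ ℚ.1ℚ → ∃ λ n0 → Good F η n0

IsB : Family → ℚ → ℕ → Set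
IsB F η b = Good F η b × (∀ n → Good F η n → b ≤ n)

IsCount : Family → ℕ → ℕ → ℕ → Set
IsCount F a L c = Σ (List (List ℕ)) λ Ls →
  length Ls ≡ c × AllPairs _≢_ Ls ×
  (∀ S → (S ∈ Ls) ⇔ (mem F S × All (InInterval a L) S))

IsMaxCount : Family → ℕ → ℕ → Set
IsMaxCount F L m =
  (∃ λ a → 1 ≤ a × IsCount F a L m) ×
  (∀ a c → 1 ≤ a → IsCount F a L c → c ℕ.≤ m)

-- θ₂(F, η) = η / (4 M(F, η/4)), given m = M(F, η/4)
θ₂ : ℚ → ℕ → ℚ
θ₂ η m = η ÷' (⟦ 4 ⟧ ℚ.* ⟦ m ⟧)

-- T = ⌈ (2 / ε_q) · B(F_q, ε_q/4) ⌉, given e = ε_q and b = B(F_q, ε_q/4)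
Tval : ℚ → ℕ → ℤ
Tval e b = ceiling ((⟦ 2 ⟧ ÷' e) ℚ.* ⟦ b ⟧)

record Chain (q : ℕ) (F : Fin (suc q) → Family) (ε : ℚ) : Set₁ where
  field
    e : Fin (suc q) → ℚ
    b : Fin (suc q) → ℕ
    m : Fin (suc q) → ℕ
    e-zero : e zero ≡ ε
    e-suc  : ∀ (p : Fin q) → e (suc p) ≡ θ₂ (e (inject₁ p)) (m (inject₁ p))
    b-def  : ∀ p → IsB (F p) (e p ÷' ⟦ 4 ⟧) (b p)
    m-def  : ∀ p → IsMaxCount (F p) (b p) (m p)

product : ∀ {k} → (Fin k → ℕ) → ℕ
product {zero} f = 1
product {suc k} f = f zero ℕ.* product (λ i → f (suc i))

{-# OPTIONS --safe #-}
module Submission where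

-- Induction on the number of coordinates; write ε = a/d with natural
-- numbers, so that every density condition becomes an inequality in ℕ.
-- Cut [n₀] into ⌊n₀/b₀⌋ blocks of length b₀ = B(F₀, ε/4). As n₀ ≥ 2b₀/ε,
-- the leftover part is negligible and D has density at least ε/2 on
-- J × ∏_{p>0}[n_p] for some block J. By Markov's inequality at least an
-- ε/4 fraction of the tails x′ have a fibre {x₀ ∈ J : (x₀, x′) ∈ D} of
-- density at least ε/4 in J, and each such fibre contains a member of F₀.
-- These members lie in J, so there are at most M = M(F₀, ε/4) of them and
-- one, w, lies in the fibres of an ε/(4M) = θ₂ fraction of the tails. The
-- induction hypothesis at density θ₂ on those tails yields I₁, …, I_q, and
-- I₀ = w completes the box.

module Ratio where

  open import Defs using (⟦_⟧; _÷'_; Tval; θ₂)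
  open import Data.Nat as ℕ using (ℕ; suc; z≤n; s≤s; _*_; _≤_)
  import Data.Nat.Properties as ℕ
  open import Data.Nat.Tactic.RingSolver using (solve-∀)
  open import Data.Integer as ℤ using (+_; +0; +[1+_]; -[1+_])
  import Data.Integer.Properties as ℤ
  open import Data.Integer.DivMod using ([n/d]*d≤n)
  open import Data.Rational as ℚ using (ℚ; mkℚ; 0ℚ; toℚᵘ)
  import Data.Rational.Properties as ℚ
  open import Data.Rational.Unnormalised as ℚᵘ using (mkℚᵘ; *≤*; *≡*)
  import Data.Rational.Unnormalised.Properties as ℚᵘ
  open import Data.Product using (Σ-syntax; _×_; _,_)
  open import Data.Empty using (⊥-elim)
  open import Relation.Nullary using (¬_; yes; no)
  open import Relation.Binary.PropositionalEquality

  -- x = a/d with d ≥ 1 (mkℚᵘ takes the denominator minus one).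
  IsRatio : ℚ → ℕ → ℕ → Set
  IsRatio x a d = 1 ≤ d × toℚᵘ x ℚᵘ.≃ mkℚᵘ (+ a) (ℕ.pred d)

  private
    +-* : ∀ m n → + m ℤ.* + n ≡ + (m * n)
    +-* m n = sym (ℤ.pos-* m n)

  IsRatio-⟦⟧ : ∀ n → IsRatio ⟦ n ⟧ n 1
  IsRatio-⟦⟧ n = s≤s z≤n , ℚ.toℚᵘ-fromℚᵘ (mkℚᵘ (+ n) 0)

  IsRatio-≤⇒ : ∀ {x y a b d e} → IsRatio x a d → IsRatio y b e → x ℚ.≤ y → a * e ≤ b * d
  IsRatio-≤⇒ {a = a} {b} {suc d} {suc e} (_ , x≃) (_ , y≃) x≤y
    with ℚᵘ.≤-respʳ-≃ y≃ (ℚᵘ.≤-respˡ-≃ x≃ (ℚ.toℚᵘ-mono-≤ x≤y))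
  ... | *≤* ad≤be = ℤ.drop‿+≤+ (subst₂ ℤ._≤_ (+-* a (suc e)) (+-* b (suc d)) ad≤be)

  IsRatio-≤⇐ : ∀ {x y a b d e} → IsRatio x a d → IsRatio y b e → a * e ≤ b * d → x ℚ.≤ y
  IsRatio-≤⇐ {a = a} {b} {suc d} {suc e} (_ , x≃) (_ , y≃) ae≤bd =
    ℚ.toℚᵘ-cancel-≤ (ℚᵘ.≤-respʳ-≃ (ℚᵘ.≃-sym y≃) (ℚᵘ.≤-respˡ-≃ (ℚᵘ.≃-sym x≃)
      (*≤* (subst₂ ℤ._≤_ (sym (+-* a (suc e))) (sym (+-* b (suc d))) (ℤ.+≤+ ae≤bd)))))

  IsRatio-* : ∀ {x y a b d e} → IsRatio x a d → IsRatio y b e → IsRatio (x ℚ.* y) (a * b) (d * e)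
  IsRatio-* {x} {y} {a} {b} {suc d} {suc e} (_ , x≃) (_ , y≃) =
    s≤s z≤n , ℚᵘ.≃-trans (ℚ.toℚᵘ-homo-* x y) (ℚᵘ.≃-trans (ℚᵘ.*-cong x≃ y≃)
      (ℚᵘ.≃-reflexive (cong (λ z → mkℚᵘ z (ℕ.pred (suc d * suc e))) (+-* a b))))

  IsRatio-1/ : ∀ {y b e} .{{_ : ℚ.NonZero y}} → IsRatio y b e → 1 ≤ b → IsRatio (ℚ.1/ y) e b
  IsRatio-1/ {mkℚ +[1+ n ] d _} {suc b} {suc e} (_ , *≡* ne≡bd) _ = s≤s z≤n , *≡* (begin
    + suc d ℤ.* + suc b ≡⟨ ℤ.*-comm (+ suc d) (+ suc b) ⟩
    + suc b ℤ.* + suc d ≡⟨ ne≡bd ⟨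
    + suc n ℤ.* + suc e ≡⟨ ℤ.*-comm (+ suc n) (+ suc e) ⟩
    + suc e ℤ.* + suc n ∎)
    where open ≡-Reasoning
  IsRatio-1/ {mkℚ -[1+ n ] d _} {suc b} {suc e} (_ , *≡* ()) _

  IsRatio⇒≢0 : ∀ {y b e} → IsRatio y b e → 1 ≤ b → y ≢ 0ℚ
  IsRatio⇒≢0 {b = suc b} (_ , *≡* ()) _ refl

  IsRatio-÷' : ∀ {x y a b d e} → IsRatio x a d → IsRatio y b e → 1 ≤ b → IsRatio (x ÷' y) (a * e) (d * b)
  IsRatio-÷' {y = y} x≡a/d y≡b/e 1≤b with y ℚ.≟ 0ℚ
  ... | yes y≡0 = ⊥-elim (IsRatio⇒≢0 y≡b/e 1≤b y≡0)
  ... | no y≢0 = IsRatio-* x≡a/d (IsRatio-1/ {{ℚ.≢-nonZero y≢0}} y≡b/e 1≤b)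

  positive⇒IsRatio : ∀ x → 0ℚ ℚ.< x → Σ[ a ∈ ℕ ] Σ[ d ∈ ℕ ] IsRatio x a d × 1 ≤ a
  positive⇒IsRatio (mkℚ +[1+ n ] d _) _ = suc n , suc d , (s≤s z≤n , ℚᵘ.≃-refl) , s≤s z≤n
  positive⇒IsRatio (mkℚ +0 d c) 0<x = ⊥-elim (ℚ.<-irrefl (sym (ℚ.↥p≡0⇒p≡0 (mkℚ +0 d c) refl)) 0<x)
  positive⇒IsRatio (mkℚ -[1+ n ] d _) (ℚ.*<* ())

  IsRatio⇒positive : ∀ {x a d} → IsRatio x a d → 1 ≤ a → 0ℚ ℚ.< x
  IsRatio⇒positive {x} {suc a} {d} x≡a/d _ = ℚ.≰⇒> λ x≤0 → a+1≰0 (IsRatio-≤⇒ x≡a/d (IsRatio-⟦⟧ 0) x≤0)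
    where
    a+1≰0 : ¬ (suc a * 1 ≤ 0 * d)
    a+1≰0 ()

  ceiling≤⇒≤ : ∀ x n → ℚ.ceiling x ℤ.≤ + n → x ℚ.≤ ⟦ n ⟧
  ceiling≤⇒≤ x@(mkℚ p d _) n ⌈x⌉≤n =
    ℚ.toℚᵘ-cancel-≤ (ℚᵘ.≤-respʳ-≃ (ℚᵘ.≃-sym (ℚ.toℚᵘ-fromℚᵘ (mkℚᵘ (+ n) 0))) (*≤* p≤n[d+1]))
    where
    open ℤ.≤-Reasoning
    ⌊-x⌋ = ℚ.floor (ℚ.- x)
    ⌊-x⌋[d+1]≤-p : ⌊-x⌋ ℤ.* + suc d ℤ.≤ ℤ.- p
    ⌊-x⌋[d+1]≤-p = subst₂ (λ u v → ⌊-x⌋ ℤ.* v ℤ.≤ u) (ℚ.↥-neg x) (ℚ.↧-neg x) (floor*↧≤↥ (ℚ.- x))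
      where
      floor*↧≤↥ : ∀ y → ℚ.floor y ℤ.* ℚ.↧ y ℤ.≤ ℚ.↥ y
      floor*↧≤↥ (mkℚ m e _) = [n/d]*d≤n m (+ suc e)
    p≤n[d+1] : p ℤ.* + 1 ℤ.≤ + n ℤ.* + suc d
    p≤n[d+1] = begin
      p ℤ.* + 1                       ≡⟨ ℤ.*-identityʳ p ⟩
      p                               ≡⟨ ℤ.neg-involutive p ⟨
      ℤ.- (ℤ.- p)                     ≤⟨ ℤ.neg-mono-≤ ⌊-x⌋[d+1]≤-p ⟩
      ℤ.- (⌊-x⌋ ℤ.* + suc d)          ≡⟨ ℤ.neg-distribˡ-* ⌊-x⌋ (+ suc d) ⟩
      ℚ.ceiling x ℤ.* + suc d         ≤⟨ ℤ.*-monoʳ-≤-nonNeg (+ suc d) ⌈x⌉≤n ⟩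
      + n ℤ.* + suc d                 ∎

  1≤4* : ∀ {m} → 1 ≤ m → 1 ≤ 4 * m
  1≤4* {m} 1≤m = ℕ.≤-trans 1≤m (ℕ.m≤n*m m 4)

  IsRatio-4* : ∀ m → IsRatio (⟦ 4 ⟧ ℚ.* ⟦ m ⟧) (4 * m) 1
  IsRatio-4* m = IsRatio-* (IsRatio-⟦⟧ 4) (IsRatio-⟦⟧ m)

  module _ {ε a d} (ε≡a/d : IsRatio ε a d) where

    Tval≤⇒ : ∀ {b n} → 1 ≤ a → Tval ε b ℤ.≤ + n → 2 * d * b ≤ a * n
    Tval≤⇒ {b} {n} 1≤a T≤n = subst₂ _≤_ (lhs d b) (rhs n a)
      (IsRatio-≤⇒ (IsRatio-* (IsRatio-÷' (IsRatio-⟦⟧ 2) ε≡a/d 1≤a) (IsRatio-⟦⟧ b)) (IsRatio-⟦⟧ n)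
        (ceiling≤⇒≤ _ n T≤n))
      where
      lhs : ∀ d b → 2 * d * b * 1 ≡ 2 * d * b
      lhs = solve-∀
      rhs : ∀ n a → n * (1 * a * 1) ≡ a * n
      rhs = solve-∀

    density⇒ : ∀ {N v} → ε ℚ.* ⟦ N ⟧ ℚ.≤ ⟦ v ⟧ → a * N ≤ d * v
    density⇒ {N} {v} εN≤v = subst₂ _≤_ (lhs a N) (rhs v d)
      (IsRatio-≤⇒ (IsRatio-* ε≡a/d (IsRatio-⟦⟧ N)) (IsRatio-⟦⟧ v) εN≤v)
      where
      lhs : ∀ a N → a * N * 1 ≡ a * N
      lhs = solve-∀
      rhs : ∀ v d → v * (d * 1) ≡ d * v
      rhs = solve-∀

    ÷'-density⇐ : ∀ {y c N v} → IsRatio y c 1 → 1 ≤ c → a * N ≤ c * d * v → (ε ÷' y) ℚ.* ⟦ N ⟧ ℚ.≤ ⟦ v ⟧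
    ÷'-density⇐ {c = c} {N} {v} y≡c 1≤c aN≤cdv = IsRatio-≤⇐
      (IsRatio-* (IsRatio-÷' ε≡a/d y≡c 1≤c) (IsRatio-⟦⟧ N)) (IsRatio-⟦⟧ v)
      (subst₂ _≤_ (lhs a N) (rhs c d v) aN≤cdv)
      where
      lhs : ∀ a N → a * N ≡ a * 1 * N * 1
      lhs = solve-∀
      rhs : ∀ c d v → c * d * v ≡ v * (d * c * 1)
      rhs = solve-∀

    quarter-density⇐ : ∀ {L v} → a * L ≤ 4 * d * v → (ε ÷' ⟦ 4 ⟧) ℚ.* ⟦ L ⟧ ℚ.≤ ⟦ v ⟧
    quarter-density⇐ {L} {v} = ÷'-density⇐ {⟦ 4 ⟧} {4} {L} {v} (IsRatio-⟦⟧ 4) (s≤s z≤n)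

    θ₂-density⇐ : ∀ {m N v} → 1 ≤ m → a * N ≤ 4 * d * m * v → θ₂ ε m ℚ.* ⟦ N ⟧ ℚ.≤ ⟦ v ⟧
    θ₂-density⇐ {m} {N} {v} 1≤m aN≤4dmv = ÷'-density⇐ (IsRatio-4* m) (1≤4* 1≤m)
      (subst (a * N ≤_) (reassoc d m v) aN≤4dmv)
      where
      reassoc : ∀ d m v → 4 * d * m * v ≡ 4 * m * d * v
      reassoc = solve-∀

    θ₂-positive : ∀ {m} → 1 ≤ a → 1 ≤ m → 0ℚ ℚ.< θ₂ ε m
    θ₂-positive {m} (s≤s _) 1≤m =
      IsRatio⇒positive (IsRatio-÷' ε≡a/d (IsRatio-4* m) (1≤4* 1≤m)) (s≤s z≤n)

module Sums where

  open import Data.Nat using (ℕ; suc; z≤n; s≤s; _+_; _*_; _≤_; _≤?_)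
  open import Data.Nat.Properties
  open import Data.List using (List; []; _∷_; _++_; map; filter; length; cartesianProductWith; deduplicate)
  open import Data.List.Properties using (length-++; length-map; filter-notAll)
  open import Data.List.Membership.Propositional using (_∈_)
  open import Data.List.Membership.Propositional.Properties using (∈-map⁺; ∈-filter⁺; ∈-deduplicate⁺; ∈-deduplicate⁻)
  open import Data.List.Relation.Binary.Subset.Propositional using (_⊆_)
  import Data.List.Relation.Unary.All as All
  open import Data.List.Relation.Unary.AllPairs using (_∷_)
  open import Data.List.Relation.Unary.Unique.Propositional using (Unique)
  open import Data.List.Relation.Unary.Any as Any using (here; there)
  open import Data.Product using (Σ-syntax; _×_; _,_)
  open import Relation.Nullary using (Dec; yes; no; ¬?)
  open import Relation.Unary using (Pred; Decidable)
  open import Relation.Binary.Definitions using (DecidableEquality)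
  open import Data.Empty using (⊥-elim)
  open import Relation.Binary.PropositionalEquality
  open import Algebra.Properties.CommutativeSemigroup +-commutativeSemigroup
    using () renaming (interchange to +-interchange)

  sumL : ∀ {A : Set} → List A → (A → ℕ) → ℕ
  sumL []       f = 0
  sumL (x ∷ xs) f = f x + sumL xs f

  syntax sumL xs (λ x → e) = ∑[ x ∈ xs ] e

  𝟙 : ∀ {P : Set} → Dec P → ℕ
  𝟙 (yes _) = 1
  𝟙 (no _)  = 0

  𝟙≤1 : ∀ {P : Set} (P? : Dec P) → 𝟙 P? ≤ 1
  𝟙≤1 (yes _) = ≤-refl
  𝟙≤1 (no _)  = z≤n

  module _ {A : Set} where

    sum-++ : ∀ (xs ys : List A) f → sumL (xs ++ ys) f ≡ sumL xs f + sumL ys f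
    sum-++ []       ys f = refl
    sum-++ (x ∷ xs) ys f = trans (cong (f x +_) (sum-++ xs ys f)) (sym (+-assoc (f x) _ _))

    sum-cong : ∀ (xs : List A) {f g} → (∀ x → f x ≡ g x) → sumL xs f ≡ sumL xs g
    sum-cong []       f≗g = refl
    sum-cong (x ∷ xs) f≗g = cong₂ _+_ (f≗g x) (sum-cong xs f≗g)

    sum-mono : ∀ (xs : List A) {f g} → (∀ x → x ∈ xs → f x ≤ g x) → sumL xs f ≤ sumL xs g
    sum-mono []       f≤g = z≤n
    sum-mono (x ∷ xs) f≤g = +-mono-≤ (f≤g x (here refl)) (sum-mono xs (λ y y∈ → f≤g y (there y∈)))

    sum-+ : ∀ (xs : List A) f g → ∑[ x ∈ xs ] (f x + g x) ≡ sumL xs f + sumL xs g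
    sum-+ []       f g = refl
    sum-+ (x ∷ xs) f g = trans (cong (f x + g x +_) (sum-+ xs f g)) (+-interchange (f x) (g x) _ _)

    sum-* : ∀ (xs : List A) c f → ∑[ x ∈ xs ] (c * f x) ≡ c * sumL xs f
    sum-* []       c f = sym (*-zeroʳ c)
    sum-* (x ∷ xs) c f = trans (cong (c * f x +_) (sum-* xs c f)) (sym (*-distribˡ-+ c (f x) _))

    sum-const : ∀ (xs : List A) c → ∑[ x ∈ xs ] c ≡ length xs * c
    sum-const []       c = refl
    sum-const (x ∷ xs) c = cong (c +_) (sum-const xs c)

    sum≤length* : ∀ (xs : List A) f c → (∀ x → f x ≤ c) → sumL xs f ≤ length xs * c
    sum≤length* xs f c f≤c = ≤-trans (sum-mono xs (λ x _ → f≤c x)) (≤-reflexive (sum-const xs c))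

    sum≤length*max : ∀ (xs : List A) f → 1 ≤ length xs → Σ[ y ∈ A ] y ∈ xs × sumL xs f ≤ length xs * f y
    sum≤length*max (x ∷ [])      f _ = x , here refl , ≤-reflexive (cong (f x +_) (sym (*-zeroʳ 0)))
    sum≤length*max (x ∷ x′ ∷ xs) f _ with sum≤length*max (x′ ∷ xs) f (s≤s z≤n)
    ... | y , y∈ , Σ≤ with f x ≤? f y
    ... | yes fx≤fy = y , there y∈ , +-mono-≤ fx≤fy Σ≤
    ... | no  fx≰fy = x , here refl , +-monoʳ-≤ (f x) (≤-trans Σ≤ (*-monoʳ-≤ (length (x′ ∷ xs)) (≰⇒≥ fx≰fy)))

    length-filter≡∑𝟙 : ∀ {P : Pred A _} (P? : Decidable P) xs → length (filter P? xs) ≡ ∑[ x ∈ xs ] 𝟙 (P? x)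
    length-filter≡∑𝟙 P? []       = refl
    length-filter≡∑𝟙 P? (x ∷ xs) with P? x
    ... | yes _ = cong suc (length-filter≡∑𝟙 P? xs)
    ... | no  _ = length-filter≡∑𝟙 P? xs

  module _ {A B : Set} where

    sum-map : ∀ (g : A → B) (xs : List A) f → sumL (map g xs) f ≡ ∑[ x ∈ xs ] f (g x)
    sum-map g []       f = refl
    sum-map g (x ∷ xs) f = cong (f (g x) +_) (sum-map g xs f)

    sum-swap : ∀ (xs : List A) (ys : List B) (f : A → B → ℕ) →
               ∑[ x ∈ xs ] ∑[ y ∈ ys ] f x y ≡ ∑[ y ∈ ys ] ∑[ x ∈ xs ] f x y
    sum-swap []       ys f = sym (trans (sum-const ys 0) (*-zeroʳ (length ys)))
    sum-swap (x ∷ xs) ys f =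
      trans (cong (sumL ys (f x) +_) (sum-swap xs ys f)) (sym (sum-+ ys (f x) (λ y → ∑[ x′ ∈ xs ] f x′ y)))

  module _ {A B C : Set} (g : A → B → C) where

    sum-cartesianProductWith : ∀ xs ys f →
      sumL (cartesianProductWith g xs ys) f ≡ ∑[ x ∈ xs ] ∑[ y ∈ ys ] f (g x y)
    sum-cartesianProductWith []       ys f = refl
    sum-cartesianProductWith (x ∷ xs) ys f = trans (sum-++ (map (g x) ys) _ f)
      (cong₂ _+_ (sum-map (g x) ys f) (sum-cartesianProductWith xs ys f))

    length-cartesianProductWith : ∀ xs ys → length (cartesianProductWith g xs ys) ≡ length xs * length ys
    length-cartesianProductWith []       ys = refl
    length-cartesianProductWith (x ∷ xs) ys =
      trans (length-++ (map (g x) ys)) (cong₂ _+_ (length-map (g x) ys) (length-cartesianProductWith xs ys))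

  module _ {A : Set} where

    sum≤cap*#above+threshold*length : ∀ (xs : List A) h {H} t → (∀ x → h x ≤ H) →
      sumL xs h ≤ H * length (filter (λ x → t ≤? h x) xs) + t * length xs
    sum≤cap*#above+threshold*length xs h {H} t h≤H = begin
      sumL xs h                                             ≤⟨ sum-mono xs (λ x _ → split x) ⟩
      ∑[ x ∈ xs ] (H * 𝟙 (t ≤? h x) + t)                    ≡⟨ sum-+ xs _ _ ⟩
      ∑[ x ∈ xs ] (H * 𝟙 (t ≤? h x)) + ∑[ x ∈ xs ] t        ≡⟨ cong₂ _+_ (sum-* xs H _) (sum-const xs t) ⟩
      H * ∑[ x ∈ xs ] 𝟙 (t ≤? h x) + length xs * t          ≡⟨ cong₂ (λ u v → H * u + v)
                                                                 (sym (length-filter≡∑𝟙 (λ x → t ≤? h x) xs)) (*-comm (length xs) t) ⟩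
      H * length (filter (λ x → t ≤? h x) xs) + t * length xs ∎
      where
      open ≤-Reasoning
      split : ∀ x → h x ≤ H * 𝟙 (t ≤? h x) + t
      split x with t ≤? h x
      ... | yes _   = ≤-trans (≤-trans (h≤H x) (≤-reflexive (sym (*-identityʳ H)))) (m≤m+n (H * 1) t)
      ... | no  t≰h = ≤-trans (<⇒≤ (≰⇒> t≰h)) (m≤n+m t (H * 0))

    pigeonhole : ∀ {B : Set} (_≟_ : DecidableEquality B) (f : A → B) (xs : List A) → 1 ≤ length xs →
      Σ[ w ∈ B ] w ∈ map f xs ×
        length xs ≤ length (deduplicate _≟_ (map f xs)) * length (filter (λ x → f x ≟ w) xs)
    pigeonhole {B} _≟_ f xs@(x ∷ _) _ = most-frequent (sum≤length*max W count (∈⇒1≤length (f∈W (here refl))))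
      where
      open ≤-Reasoning
      W = deduplicate _≟_ (map f xs)
      count : B → ℕ
      count w = length (filter (λ x → f x ≟ w) xs)
      f∈W : ∀ {y} → y ∈ xs → f y ∈ W
      f∈W y∈xs = ∈-deduplicate⁺ _≟_ (∈-map⁺ f y∈xs)
      ∈⇒1≤length : ∀ {y : B} {ys} → y ∈ ys → 1 ≤ length ys
      ∈⇒1≤length (here _)  = s≤s z≤n
      ∈⇒1≤length (there _) = s≤s z≤n
      1≤∑𝟙 : ∀ {y : B} {ys} → y ∈ ys → 1 ≤ ∑[ w ∈ ys ] 𝟙 (y ≟ w)
      1≤∑𝟙 {y} (here refl) with y ≟ y
      ... | yes _   = s≤s z≤n
      ... | no  y≢y = ⊥-elim (y≢y refl)
      1≤∑𝟙 {y} {w ∷ ws} (there y∈ws) = ≤-trans (1≤∑𝟙 y∈ws) (m≤n+m _ (𝟙 (y ≟ w)))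
      most-frequent : Σ[ w ∈ B ] w ∈ W × sumL W count ≤ length W * count w →
        Σ[ w ∈ B ] w ∈ map f xs × length xs ≤ length W * count w
      most-frequent (w , w∈W , Σ≤) = w , ∈-deduplicate⁻ _≟_ (map f xs) w∈W , (begin
        length xs                              ≡⟨ *-identityʳ (length xs) ⟨
        length xs * 1                          ≡⟨ sum-const xs 1 ⟨
        ∑[ x ∈ xs ] 1                          ≤⟨ sum-mono xs (λ x x∈xs → 1≤∑𝟙 (f∈W x∈xs)) ⟩
        ∑[ x ∈ xs ] ∑[ w ∈ W ] 𝟙 (f x ≟ w)     ≡⟨ sum-swap xs W _ ⟩
        ∑[ w ∈ W ] ∑[ x ∈ xs ] 𝟙 (f x ≟ w)     ≡⟨ sum-cong W (λ w → length-filter≡∑𝟙 (λ x → f x ≟ w) xs) ⟨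
        sumL W count                           ≤⟨ Σ≤ ⟩
        length W * count w                     ∎)

  Unique⇒length≤ : ∀ {A : Set} → DecidableEquality A → ∀ {xs ys : List A} →
                   Unique xs → xs ⊆ ys → length xs ≤ length ys
  Unique⇒length≤ _≟_ {[]}     _          _    = z≤n
  Unique⇒length≤ _≟_ {x ∷ xs} {ys} (x∉xs ∷ u) x∷xs⊆ys =
    ≤-trans (s≤s (Unique⇒length≤ _≟_ u xs⊆ys-x)) (filter-notAll (λ y → ¬? (x ≟ y)) ys x∈ys)
    where
    x∈ys = Any.map (λ x≡y x≢y → x≢y x≡y) (x∷xs⊆ys (here refl))
    xs⊆ys-x : xs ⊆ filter (λ y → ¬? (x ≟ y)) ys
    xs⊆ys-x z∈xs = ∈-filter⁺ (λ y → ¬? (x ≟ y)) (x∷xs⊆ys (there z∈xs)) (All.lookup x∉xs z∈xs)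

module Intervals where

  open import Defs using (InInterval; IsFinSet)
  open Sums
  open import Data.Nat using (ℕ; zero; suc; z≤n; s≤s; _+_; _*_; _≤_; _<_; NonZero)
  open import Data.Nat.DivMod using (_/_; _%_; m≡m%n+[m/n]*n; m%n<n)
  open import Data.Nat.Properties
  open import Data.List using (List; []; _∷_; _++_; map; length)
  open import Data.List.Membership.Propositional using (_∈_)
  open import Data.List.Relation.Unary.Any using (here; there)
  import Data.List.Relation.Unary.All as All
  open import Data.List.Relation.Unary.AllPairs using (_∷_; [])
  open import Data.Product using (_,_; proj₁)
  open import Data.Empty using (⊥-elim)
  open import Relation.Nullary using (yes; no)
  open import Relation.Binary.PropositionalEquality

  interval : ℕ → ℕ → List ℕ
  interval s zero    = []
  interval s (suc L) = s ∷ interval (suc s) L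

  ∈-interval⁻ : ∀ {s L x} → x ∈ interval s L → InInterval s L x
  ∈-interval⁻ {s} {suc L} (here refl) = ≤-refl , m<m+n s (s≤s z≤n)
  ∈-interval⁻ {s} {suc L} {x} (there x∈) with ∈-interval⁻ x∈
  ... | s<x , x<s+1+L = <⇒≤ s<x , subst (x <_) (sym (+-suc s L)) x<s+1+L

  ∈-interval⁺ : ∀ {s L x} → InInterval s L x → x ∈ interval s L
  ∈-interval⁺ {s} {zero}  (s≤x , x<s+0) = ⊥-elim (<⇒≱ x<s+0 (≤-trans (≤-reflexive (+-identityʳ s)) s≤x))
  ∈-interval⁺ {s} {suc L} {x} (s≤x , x<s+1+L) with s ≟ x
  ... | yes refl = here refl
  ... | no  s≢x  = there (∈-interval⁺ (≤∧≢⇒< s≤x s≢x , subst (x <_) (+-suc s L) x<s+1+L))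

  interval-increasing : ∀ s L → IsFinSet (interval s L)
  interval-increasing s zero    = []
  interval-increasing s (suc L) = All.tabulate (λ x∈ → proj₁ (∈-interval⁻ x∈)) ∷ interval-increasing (suc s) L

  length-interval : ∀ s L → length (interval s L) ≡ L
  length-interval s zero    = refl
  length-interval s (suc L) = cong suc (length-interval (suc s) L)

  interval-++ : ∀ s L M → interval s (L + M) ≡ interval s L ++ interval (s + L) M
  interval-++ s zero    M = cong (λ t → interval t M) (sym (+-identityʳ s))
  interval-++ s (suc L) M = cong (s ∷_) (trans (interval-++ (suc s) L M)
    (cong (λ t → interval (suc s) L ++ interval t M) (sym (+-suc s L))))

  interval-suc : ∀ s L → interval (suc s) L ≡ map suc (interval s L)
  interval-suc s zero    = refl
  interval-suc s (suc L) = cong (suc s ∷_) (interval-suc (suc s) L)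

  sum-interval≤ : ∀ s L f → (∀ x → f x ≤ 1) → sumL (interval s L) f ≤ L
  sum-interval≤ s L f f≤1 = ≤-trans (sum≤length* (interval s L) f 1 f≤1)
    (≤-reflexive (trans (*-identityʳ _) (length-interval s L)))

  sum-interval-blocks : ∀ k b s f →
    sumL (interval s (k * b)) f ≡ ∑[ j ∈ interval 0 k ] sumL (interval (s + j * b) b) f
  sum-interval-blocks zero    b s f = refl
  sum-interval-blocks (suc k) b s f = begin
    sumL (interval s (b + k * b)) f
      ≡⟨ cong (λ xs → sumL xs f) (interval-++ s b (k * b)) ⟩
    sumL (interval s b ++ interval (s + b) (k * b)) f
      ≡⟨ sum-++ (interval s b) _ f ⟩
    sumL (interval s b) f + sumL (interval (s + b) (k * b)) f
      ≡⟨ cong₂ _+_ (cong (λ t → sumL (interval t b) f) (sym (+-identityʳ s))) (sum-interval-blocks k b (s + b) f) ⟩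
    sumL (interval (s + 0) b) f + ∑[ j ∈ interval 0 k ] sumL (interval (s + b + j * b) b) f
      ≡⟨ cong (sumL (interval (s + 0) b) f +_)
           (sum-cong (interval 0 k) (λ j → cong (λ t → sumL (interval t b) f) (+-assoc s b (j * b)))) ⟩
    sumL (interval (s + 0) b) f + ∑[ j ∈ interval 0 k ] sumL (interval (s + suc j * b) b) f
      ≡⟨ cong (sumL (interval (s + 0) b) f +_)
           (sym (trans (cong (λ xs → sumL xs _) (interval-suc 0 k)) (sum-map suc (interval 0 k) _))) ⟩
    ∑[ j ∈ interval 0 (suc k) ] sumL (interval (s + j * b) b) f ∎
    where open ≡-Reasoning

  sum-interval≤blocks : ∀ s n b .{{_ : NonZero b}} f → (∀ x → f x ≤ 1) →
    sumL (interval s n) f ≤ ∑[ j ∈ interval 0 (n / b) ] sumL (interval (s + j * b) b) f + b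
  sum-interval≤blocks s n b f f≤1 = begin
    sumL (interval s n) f                                         ≡⟨ cong (λ t → sumL (interval s t) f) n≡qb+r ⟩
    sumL (interval s (q * b + r)) f                               ≡⟨ cong (λ xs → sumL xs f) (interval-++ s (q * b) r) ⟩
    sumL (interval s (q * b) ++ interval (s + q * b) r) f         ≡⟨ sum-++ (interval s (q * b)) _ f ⟩
    sumL (interval s (q * b)) f + sumL (interval (s + q * b) r) f ≤⟨ +-mono-≤ (≤-reflexive (sum-interval-blocks q b s f))
                                                                       (≤-trans (sum-interval≤ _ r f f≤1) (<⇒≤ (m%n<n n b))) ⟩
    ∑[ j ∈ interval 0 q ] sumL (interval (s + j * b) b) f + b      ∎
    where
    open ≤-Reasoning
    q = n / b
    r = n % b
    n≡qb+r : n ≡ q * b + r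
    n≡qb+r = trans (m≡m%n+[m/n]*n n b) (+-comm r (q * b))

module Grid where

  open import Defs using (In[_]; product)
  open Sums using (length-cartesianProductWith)
  open Intervals
  open import Data.Nat using (ℕ; zero; suc; s≤s; _*_)
  open import Data.Nat.Properties using (<-irrefl)
  open import Data.Fin using (Fin; zero; suc)
  open import Data.Vec using (Vec; []; _∷_; lookup)
  import Data.Vec.Properties as Vec
  open import Data.List using (List; []; _∷_; length; cartesianProductWith)
  open import Data.List.Membership.Propositional using (_∈_)
  open import Data.List.Membership.Propositional.Properties
    using (∈-cartesianProductWith⁺; ∈-cartesianProductWith⁻)
  open import Data.List.Relation.Unary.Any using (here)
  import Data.List.Relation.Unary.All as All
  open import Data.List.Relation.Unary.AllPairs as AllPairs using ([]; _∷_)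
  open import Data.List.Relation.Unary.Unique.Propositional using (Unique)
  import Data.List.Relation.Unary.Unique.Propositional.Properties as Unique
  open import Data.Product using (_,_)
  open import Relation.Binary.PropositionalEquality

  grid : (k : ℕ) → (Fin k → ℕ) → List (Vec ℕ k)
  grid zero    n = [] ∷ []
  grid (suc k) n = cartesianProductWith _∷_ (interval 1 (n zero)) (grid k (λ p → n (suc p)))

  length-grid : ∀ k n → length (grid k n) ≡ product n
  length-grid zero    n = refl
  length-grid (suc k) n = trans (length-cartesianProductWith _∷_ (interval 1 (n zero)) _)
    (cong₂ _*_ (length-interval 1 (n zero)) (length-grid k (λ p → n (suc p))))

  grid-unique : ∀ k n → Unique (grid k n)
  grid-unique zero    n = All.[] ∷ []
  grid-unique (suc k) n = Unique.cartesianProductWith⁺ _∷_ Vec.∷-injective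
    (AllPairs.map (λ x<y x≡y → <-irrefl x≡y x<y) (interval-increasing 1 (n zero)))
    (grid-unique k (λ p → n (suc p)))

  ∈-grid⁺ : ∀ k n {x : Vec ℕ k} → (∀ p → In[ n p ] (lookup x p)) → x ∈ grid k n
  ∈-grid⁺ zero    n {[]}    _     = here refl
  ∈-grid⁺ (suc k) n {x ∷ y} x∈n with 1≤x , x≤n ← x∈n zero =
    ∈-cartesianProductWith⁺ _∷_ (∈-interval⁺ (1≤x , s≤s x≤n))
      (∈-grid⁺ k (λ p → n (suc p)) (λ p → x∈n (suc p)))

  ∈-grid⁻ : ∀ k n {x : Vec ℕ k} → x ∈ grid k n → ∀ p → In[ n p ] (lookup x p)
  ∈-grid⁻ (suc k) n x∈ p
    with x , y , x∈I , y∈G , refl ← ∈-cartesianProductWith⁻ _∷_ (interval 1 (n zero)) _ x∈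
    with p
  ... | zero  with 1≤x , s≤s x≤n ← ∈-interval⁻ x∈I = 1≤x , x≤n
  ... | suc p = ∈-grid⁻ k (λ p → n (suc p)) y∈G p

module MaxCount where

  open import Defs using (mem; mem-set; IsFinSet; InInterval; IsCount; IsMaxCount)
  open Sums using (Unique⇒length≤)
  open import Data.Nat using (ℕ; zero; suc; s≤s; _≤_; _<_; _≤?_; _≟_)
  open import Data.Nat.Properties using (≤-trans; ≤-refl; <⇒≱; n≤1+n; m≤m+n; ≤∧≢⇒<; +-suc; +-identityʳ)
  open import Data.List using (List; []; _∷_; _++_; map; length; deduplicate)
  open import Data.List.Properties using (≡-dec)
  open import Data.List.Membership.Propositional using (_∈_)
  open import Data.List.Membership.Propositional.Properties
    using (∈-++⁺ˡ; ∈-++⁺ʳ; ∈-++⁻; ∈-map⁺; ∈-map⁻; ∈-deduplicate⁺; ∈-deduplicate⁻)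
  open import Data.List.Relation.Unary.Any using (here; there)
  open import Data.List.Relation.Unary.All as All using (All; []; _∷_)
  open import Data.List.Relation.Unary.AllPairs using ([]; _∷_)
  open import Data.List.Relation.Unary.Unique.Propositional using (Unique)
  open import Data.List.Relation.Unary.Unique.DecPropositional.Properties using (deduplicate-!)
  open import Data.Product using (Σ-syntax; _×_; _,_; map₁)
  open import Data.Sum using (inj₁; inj₂)
  open import Data.Empty using (⊥-elim)
  open import Effect.Monad using (RawMonad)
  open import Function.Bundles using (_⇔_; mk⇔; Equivalence)
  open import Relation.Binary.Definitions using (DecidableEquality)
  open import Relation.Nullary using (¬_; Dec; yes; no)
  open import Relation.Nullary.Decidable using (¬¬-excluded-middle)
  open import Relation.Nullary.Negation using (¬¬-Monad; ¬¬-map)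
  open import Relation.Binary.PropositionalEquality using (refl; sym; subst)

  -- Members of a family need not be decidable, so the sublist of its
  -- members can only be formed under a double negation.
  ¬¬-filter : ∀ {A : Set} (P : A → Set) (xs : List A) → ¬ ¬ (Σ[ ys ∈ List A ] (∀ x → x ∈ ys ⇔ (x ∈ xs × P x)))
  ¬¬-filter P []       = return ([] , λ x → mk⇔ (λ ()) (λ ()))
    where open RawMonad ¬¬-Monad
  ¬¬-filter P (x ∷ xs) = do
    ys , ys⇔ ← ¬¬-filter P xs
    P?x ← ¬¬-excluded-middle
    return (extend ys ys⇔ P?x)
    where
    open RawMonad ¬¬-Monad
    extend : ∀ ys → (∀ z → z ∈ ys ⇔ (z ∈ xs × P z)) → Dec (P x) →
             Σ[ zs ∈ List _ ] (∀ z → z ∈ zs ⇔ (z ∈ x ∷ xs × P z))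
    extend ys ys⇔ (yes Px) = x ∷ ys , λ z → mk⇔
      (λ { (here refl) → here refl , Px ; (there z∈) → map₁ there (Equivalence.to (ys⇔ z) z∈) })
      (λ { (here refl , _) → here refl ; (there z∈ , Pz) → there (Equivalence.from (ys⇔ z) (z∈ , Pz)) })
    extend ys ys⇔ (no ¬Px) = ys , λ z → mk⇔
      (λ z∈ → map₁ there (Equivalence.to (ys⇔ z) z∈))
      (λ { (here refl , Pz) → ⊥-elim (¬Px Pz) ; (there z∈ , Pz) → Equivalence.from (ys⇔ z) (z∈ , Pz) })

  subsets : ℕ → ℕ → List (List ℕ)
  subsets a zero    = [] ∷ []
  subsets a (suc L) = subsets (suc a) L ++ map (a ∷_) (subsets (suc a) L)

  private
    widen : ∀ {a L x} → InInterval (suc a) L x → InInterval a (suc L) x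
    widen {a} {L} {x} (a<x , x<1+a+L) = ≤-trans (n≤1+n a) a<x , subst (x <_) (sym (+-suc a L)) x<1+a+L

    narrow : ∀ {a L x} → a < x → InInterval a (suc L) x → InInterval (suc a) L x
    narrow {a} {L} {x} a<x (_ , x<a+1+L) = a<x , subst (x <_) (+-suc a L) x<a+1+L

  ∈-subsets⁻ : ∀ a L {S} → S ∈ subsets a L → All (InInterval a L) S
  ∈-subsets⁻ a zero    (here refl) = []
  ∈-subsets⁻ a (suc L) S∈ with ∈-++⁻ (subsets (suc a) L) S∈
  ... | inj₁ S∈′ = All.map widen (∈-subsets⁻ (suc a) L S∈′)
  ... | inj₂ S∈′ with S , S∈″ , refl ← ∈-map⁻ (a ∷_) S∈′ =
    (≤-refl , subst (a <_) (sym (+-suc a L)) (s≤s (m≤m+n a L))) ∷ All.map widen (∈-subsets⁻ (suc a) L S∈″)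

  ∈-subsets⁺ : ∀ a L {S} → IsFinSet S → All (InInterval a L) S → S ∈ subsets a L
  ∈-subsets⁺ a zero    {[]}    _ _ = here refl
  ∈-subsets⁺ a zero    {x ∷ S} _ ((a≤x , x<a+0) ∷ _) = ⊥-elim (<⇒≱ x<a+0 (subst (_≤ x) (sym (+-identityʳ a)) a≤x))
  ∈-subsets⁺ a (suc L) {[]}    _ _ = ∈-++⁺ˡ (∈-subsets⁺ (suc a) L [] [])
  ∈-subsets⁺ a (suc L) {x ∷ S} (x<S ∷ S-inc) (x∈I@(a≤x , _) ∷ S∈I) with a ≟ x
  ... | yes refl = ∈-++⁺ʳ (subsets (suc a) L) (∈-map⁺ (a ∷_) (∈-subsets⁺ (suc a) L S-inc
    (All.zipWith (λ (a<y , y∈I) → narrow a<y y∈I) (x<S , S∈I))))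
  ... | no  a≢x  = ∈-++⁺ˡ (∈-subsets⁺ (suc a) L (x<S ∷ S-inc) (narrow a<x x∈I ∷
    All.zipWith (λ (x<y , y∈I) → narrow (≤-trans (s≤s a≤x) x<y) y∈I) (x<S , S∈I)))
    where a<x = ≤∧≢⇒< a≤x a≢x

  private
    _≟ₗ_ : DecidableEquality (List ℕ)
    _≟ₗ_ = ≡-dec _≟_

  ¬¬-IsCount : ∀ F a L → ¬ ¬ (Σ[ c ∈ ℕ ] IsCount F a L c)
  ¬¬-IsCount F a L = ¬¬-map count (¬¬-filter (mem F) (subsets a L))
    where
    count : Σ[ ys ∈ List (List ℕ) ] (∀ S → S ∈ ys ⇔ (S ∈ subsets a L × mem F S)) → Σ[ c ∈ ℕ ] IsCount F a L c
    count (ys , ys⇔) = length Ls , Ls , refl , deduplicate-! _≟ₗ_ ys , λ S → mk⇔ (to S) (from S)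
      where
      Ls = deduplicate _≟ₗ_ ys
      to : ∀ S → S ∈ Ls → mem F S × All (InInterval a L) S
      to S S∈ with S∈subsets , FS ← Equivalence.to (ys⇔ S) (∈-deduplicate⁻ _≟ₗ_ ys S∈) =
        FS , ∈-subsets⁻ a L S∈subsets
      from : ∀ S → mem F S × All (InInterval a L) S → S ∈ Ls
      from S (FS , S⊆I) = ∈-deduplicate⁺ _≟ₗ_ (Equivalence.from (ys⇔ S) (∈-subsets⁺ a L (mem-set F FS) S⊆I , FS))

  IsMaxCount⇒length≤ : ∀ F {L m a} → IsMaxCount F L m → 1 ≤ a → {W : List (List ℕ)} → Unique W →
                       All (λ S → mem F S × All (InInterval a L) S) W → length W ≤ m
  IsMaxCount⇒length≤ F {L} {m} {a} (_ , count≤m) 1≤a {W} W-unique W⊆F with length W ≤? m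
  ... | yes W≤m = W≤m
  ... | no  W≰m = ⊥-elim (¬¬-IsCount F a L λ (c , count@(Ls , |Ls|≡c , _ , Ls⇔)) →
    W≰m (≤-trans (Unique⇒length≤ _≟ₗ_ W-unique (λ S∈W → Equivalence.from (Ls⇔ _) (All.lookup W⊆F S∈W)))
                 (subst (_≤ m) (sym |Ls|≡c) (count≤m a c 1≤a count))))

module Levels where

  open import Defs
  open Ratio
  open Intervals
  open MaxCount using (IsMaxCount⇒length≤)
  open import Data.Nat using (ℕ; zero; suc; z≤n; s≤s; _*_; _≤_; >-nonZero)
  open import Data.Nat.Properties
    using (≤-trans; ≤-refl; ≤-reflexive; *-monoˡ-≤; *-mono-≤; m≤n*m; m≤m*n; *-identityʳ; *-identityˡ; *-zeroʳ; n≮0;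
           module ≤-Reasoning)
  open import Data.Integer as ℤ using (+_)
  open import Data.Rational as ℚ using (ℚ; 0ℚ; 1ℚ)
  import Data.Rational.Properties as ℚ
  open import Data.Fin using (Fin; zero; suc)
  open import Data.Vec.Functional using (tail)
  open import Data.List using ([]; _∷_)
  import Data.List.Relation.Unary.All as All
  open import Data.List.Relation.Unary.AllPairs using ([]; _∷_)
  open import Data.Product using (_×_; _,_; proj₁)
  open import Data.Unit using (⊤; tt)
  open import Relation.Nullary using (contradiction)
  open import Relation.Binary.PropositionalEquality

  1≤m*n⇒1≤n : ∀ m {n} → 1 ≤ m * n → 1 ≤ n
  1≤m*n⇒1≤n m {zero}  1≤m*0 = contradiction (≤-trans 1≤m*0 (≤-reflexive (*-zeroʳ m))) n≮0
  1≤m*n⇒1≤n m {suc n} _     = s≤s z≤n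

  record Admissible₁ (ε : ℚ) (F : Family) (b m n : ℕ) : Set where
    field
      good     : Good F (ε ÷' ⟦ 4 ⟧) b
      maxCount : IsMaxCount F b m
      long     : Tval ε b ℤ.≤ + n

  Admissible : (k : ℕ) → ℚ → (Fin k → Family) → (b m n : Fin k → ℕ) → Set
  Admissible zero    ε F b m n = ⊤
  Admissible (suc k) ε F b m n = Admissible₁ ε (F zero) (b zero) (m zero) (n zero) ×
    Admissible k (θ₂ ε (m zero)) (tail F) (tail b) (tail m) (tail n)

  Chain⇒Admissible : ∀ {q F ε} (ch : Chain q F ε) n → (∀ p → Tval (Chain.e ch p) (Chain.b ch p) ℤ.≤ + n p) →
                     Admissible (suc q) ε F (Chain.b ch) (Chain.m ch) n
  Chain⇒Admissible {q} {F} ch n long =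
    subst (λ ε → Admissible (suc q) ε F (Chain.b ch) (Chain.m ch) n) (Chain.e-zero ch) (from-head ch n long)
    where
    from-head : ∀ {q F ε} (ch : Chain q F ε) n → (∀ p → Tval (Chain.e ch p) (Chain.b ch p) ℤ.≤ + n p) →
                Admissible (suc q) (Chain.e ch zero) F (Chain.b ch) (Chain.m ch) n
    from-head {zero} ch n long =
      record { good = proj₁ (Chain.b-def ch zero) ; maxCount = Chain.m-def ch zero ; long = long zero } , tt
    from-head {suc q} {F} ch n long =
      record { good = proj₁ (Chain.b-def ch zero) ; maxCount = Chain.m-def ch zero ; long = long zero } ,
      subst (λ ε → Admissible (suc q) ε (tail F) (tail (Chain.b ch)) (tail (Chain.m ch)) (tail n))
        (Chain.e-suc ch zero) (from-head tail-chain (tail n) (λ p → long (suc p)))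
      where
      tail-chain : Chain q (tail F) (Chain.e ch (suc zero))
      tail-chain = record
        { e = tail (Chain.e ch) ; b = tail (Chain.b ch) ; m = tail (Chain.m ch)
        ; e-zero = refl
        ; e-suc = λ p → Chain.e-suc ch (suc p)
        ; b-def = λ p → Chain.b-def ch (suc p)
        ; m-def = λ p → Chain.m-def ch (suc p) }

  Good⇒1≤ : ∀ {F η} b → Good F η b → 1 ≤ b
  Good⇒1≤ (suc b) _ = s≤s z≤n
  Good⇒1≤ {F} {η} zero good with good 1 0 (s≤s z≤n) z≤n [] [] All.[] (ℚ.≤-reflexive (ℚ.*-zeroʳ η))
  ... | []    , FS , _      = contradiction refl (mem-ne F FS)
  ... | _ ∷ _ , _  , () All.∷ _

  Good⇒1≤maxCount : ∀ {F η b m} → Good F η b → IsMaxCount F b m → η ℚ.* ⟦ b ⟧ ℚ.≤ ⟦ b ⟧ → 1 ≤ m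
  Good⇒1≤maxCount {F} {η} {b} good maxCount η≤1
    with S , FS , S⊆I ← good 1 b ≤-refl ≤-refl (interval 1 b) (interval-increasing 1 b) (All.tabulate ∈-interval⁻)
                          (subst (λ L → η ℚ.* ⟦ b ⟧ ℚ.≤ ⟦ L ⟧) (sym (length-interval 1 b)) η≤1)
    = IsMaxCount⇒length≤ F maxCount ≤-refl {S ∷ []} (All.[] ∷ []) ((FS , All.map ∈-interval⁻ S⊆I) All.∷ All.[])

  record LevelBounds (ε : ℚ) (b m n : ℕ) : Set where
    field
      a d    : ℕ
      ε≡a/d  : IsRatio ε a d
      1≤a    : 1 ≤ a
      a≤d    : a ≤ d
      1≤b    : 1 ≤ b
      1≤m    : 1 ≤ m
      2db≤an : 2 * d * b ≤ a * n

    1≤n : 1 ≤ n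
    1≤n = 1≤m*n⇒1≤n a (≤-trans (*-mono-≤ (*-mono-≤ {1} {2} (s≤s z≤n) (≤-trans 1≤a a≤d)) 1≤b) 2db≤an)

    next-positive : 0ℚ ℚ.< θ₂ ε m
    next-positive = θ₂-positive ε≡a/d 1≤a 1≤m

    next≤1 : θ₂ ε m ℚ.≤ 1ℚ
    next≤1 = ℚ.≤-trans (ℚ.≤-reflexive (sym (ℚ.*-identityʳ _))) (θ₂-density⇐ ε≡a/d 1≤m (begin
      a * 1             ≡⟨ *-identityʳ a ⟩
      a                 ≤⟨ a≤d ⟩
      d                 ≤⟨ m≤n*m d 4 ⟩
      4 * d             ≤⟨ m≤m*n (4 * d) m {{>-nonZero 1≤m}} ⟩
      4 * d * m         ≡⟨ *-identityʳ (4 * d * m) ⟨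
      4 * d * m * 1     ∎))
      where open ≤-Reasoning

  levelBounds : ∀ {ε F b m n} → 0ℚ ℚ.< ε → ε ℚ.≤ 1ℚ → Admissible₁ ε F b m n → LevelBounds ε b m n
  levelBounds {ε} {F} {b} {m} {n} 0<ε ε≤1 adm with a , d , ε≡a/d , 1≤a ← positive⇒IsRatio ε 0<ε = record
    { a = a ; d = d ; ε≡a/d = ε≡a/d ; 1≤a = 1≤a ; a≤d = a≤d ; 1≤b = Good⇒1≤ {F} {ε ÷' ⟦ 4 ⟧} b good
    ; 1≤m = Good⇒1≤maxCount {F} {ε ÷' ⟦ 4 ⟧} good maxCount
        (quarter-density⇐ ε≡a/d (≤-trans (*-monoˡ-≤ b a≤d) (*-monoˡ-≤ b (m≤n*m d 4))))
    ; 2db≤an = Tval≤⇒ ε≡a/d 1≤a long }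
    where
    open Admissible₁ adm
    a≤d : a ≤ d
    a≤d = subst₂ _≤_ (*-identityʳ a) (*-identityˡ d) (IsRatio-≤⇒ ε≡a/d (IsRatio-⟦⟧ 1) ε≤1)

  Admissible⇒1≤n : ∀ k {ε F b m n} → 0ℚ ℚ.< ε → ε ℚ.≤ 1ℚ → Admissible k ε F b m n → ∀ p → 1 ≤ n p
  Admissible⇒1≤n (suc k) 0<ε ε≤1 (adm₁ , adm) zero    = LevelBounds.1≤n (levelBounds 0<ε ε≤1 adm₁)
  Admissible⇒1≤n (suc k) 0<ε ε≤1 (adm₁ , adm) (suc p) =
    Admissible⇒1≤n k (LevelBounds.next-positive lb) (LevelBounds.next≤1 lb) adm p
    where lb = levelBounds 0<ε ε≤1 adm₁

  1≤product : ∀ {k} (n : Fin k → ℕ) → (∀ p → 1 ≤ n p) → 1 ≤ product n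
  1≤product {zero}  n 1≤n = ≤-refl
  1≤product {suc k} n 1≤n = *-mono-≤ (1≤n zero) (1≤product (tail n) (λ p → 1≤n (suc p)))

module Box where

  open import Defs
  open Ratio
  open Sums
  open Intervals
  open Grid
  open MaxCount using (IsMaxCount⇒length≤)
  open Levels
  open import Data.Nat as ℕ using (ℕ; zero; suc; z≤n; s≤s; _+_; _*_; _≤_; _<_; _≤?_; NonZero; >-nonZero)
  open import Data.Nat.Properties
  open import Data.Nat.DivMod using (_/_; m/n*n≤m; m≥n⇒m/n>0)
  open import Data.Nat.Tactic.RingSolver using (solve-∀)
  open import Algebra.Properties.CommutativeSemigroup *-commutativeSemigroup using (x∙yz≈y∙xz)
  open import Data.Rational as ℚ using (ℚ; 0ℚ; 1ℚ)
  import Data.Rational.Properties as ℚ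
  open import Data.Fin using (Fin; zero; suc)
  open import Data.Vec as Vec using (Vec; []; _∷_; lookup)
  import Data.Vec.Properties as Vec
  open import Data.Vec.Functional using (tail)
  open import Data.List using (List; []; _∷_; map; filter; length; deduplicate)
  open import Data.List.Properties using (≡-dec; length-filter)
  open import Data.List.Membership.Propositional using (_∈_)
  open import Data.List.Membership.Propositional.Properties
    using (∈-filter⁺; ∈-filter⁻; ∈-map⁻; ∈-deduplicate⁻)
  import Data.List.Membership.DecPropositional as DecMembership
  open import Data.List.Relation.Unary.Any using (here)
  open import Data.List.Relation.Unary.All as All using (All; []; _∷_)
  import Data.List.Relation.Unary.All.Properties as All
  import Data.List.Relation.Unary.AllPairs.Properties as AllPairs
  open import Data.List.Relation.Unary.Unique.Propositional using (Unique)
  import Data.List.Relation.Unary.Unique.Propositional.Properties as Unique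
  open import Data.List.Relation.Unary.Unique.DecPropositional.Properties using (deduplicate-!)
  import Data.List.Relation.Binary.Sublist.Propositional.Properties as Sublist
  open import Data.Product using (Σ-syntax; _×_; _,_; proj₁; proj₂)
  open import Relation.Binary.Definitions using (DecidableEquality)
  open import Relation.Nullary using (Dec; yes; no; contradiction)
  open import Relation.Binary.PropositionalEquality using (_≡_; refl; sym; trans; cong; cong₂; subst; subst₂)

  InGrid : ∀ {k} → (Fin k → ℕ) → Vec ℕ k → Set
  InGrid n x = ∀ p → In[ n p ] (lookup x p)

  HasBox : ∀ {k} → (Fin k → Family) → (Fin k → ℕ) → List (Vec ℕ k) → Set
  HasBox {k} F n D = Σ[ I ∈ (Fin k → List ℕ) ]
    (∀ p → mem (F p) (I p) × All In[ n p ] (I p)) × (∀ (x : Vec ℕ k) → (∀ p → lookup x p ∈ I p) → x ∈ D)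

  private
    _≟ₗ_ : DecidableEquality (List ℕ)
    _≟ₗ_ = ≡-dec ℕ._≟_

  module Step {k ε} {F : Fin (suc k) → Family} {b m n : Fin (suc k) → ℕ}
    (lb : LevelBounds ε (b zero) (m zero) (n zero)) (adm₁ : Admissible₁ ε (F zero) (b zero) (m zero) (n zero))
    (1≤N′ : 1 ≤ product (tail n))
    {D : List (Vec ℕ (suc k))} (D-unique : Unique D) (D⊆grid : All (InGrid n) D)
    (D-dense : ε ℚ.* ⟦ product n ⟧ ℚ.≤ ⟦ length D ⟧) where

    open LevelBounds lb
    open Admissible₁ adm₁
    _≟ᵥ_ : DecidableEquality (Vec ℕ (suc k))
    _≟ᵥ_ = Vec.≡-dec ℕ._≟_

    open DecMembership _≟ᵥ_ using (_∈?_)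

    F₀ = F zero
    b₀ = b zero
    m₀ = m zero
    n₀ = n zero
    n′ = tail n
    G′ = grid k n′
    N′ = product n′

    instance
      b₀-nonZero : NonZero b₀
      b₀-nonZero = >-nonZero 1≤b

    χ : Vec ℕ k → ℕ → ℕ
    χ x′ x₀ = 𝟙 ((x₀ ∷ x′) ∈? D)

    blocks : ℕ
    blocks = n₀ / b₀

    block-start : ℕ → ℕ
    block-start j = 1 + j * b₀

    mass : ℕ → ℕ
    mass j = ∑[ x′ ∈ G′ ] sumL (interval (block-start j) b₀) (χ x′)

    length≤∑mass : length D ≤ ∑[ j ∈ interval 0 blocks ] mass j + N′ * b₀
    length≤∑mass = begin
      length D
        ≤⟨ Unique⇒length≤ _≟ᵥ_ D-unique
             (λ x∈D → ∈-filter⁺ (_∈? D) (∈-grid⁺ (suc k) n (All.lookup D⊆grid x∈D)) x∈D) ⟩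
      length (filter (_∈? D) (grid (suc k) n))
        ≡⟨ length-filter≡∑𝟙 (_∈? D) (grid (suc k) n) ⟩
      ∑[ x ∈ grid (suc k) n ] 𝟙 (x ∈? D)
        ≡⟨ sum-cartesianProductWith _∷_ (interval 1 n₀) G′ _ ⟩
      ∑[ x₀ ∈ interval 1 n₀ ] ∑[ x′ ∈ G′ ] χ x′ x₀
        ≡⟨ sum-swap (interval 1 n₀) G′ _ ⟩
      ∑[ x′ ∈ G′ ] sumL (interval 1 n₀) (χ x′)
        ≤⟨ sum-mono G′ (λ x′ _ → sum-interval≤blocks 1 n₀ b₀ (χ x′) (λ x₀ → 𝟙≤1 _)) ⟩
      ∑[ x′ ∈ G′ ] (∑[ j ∈ interval 0 blocks ] sumL (interval (block-start j) b₀) (χ x′) + b₀)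
        ≡⟨ sum-+ G′ _ _ ⟩
      ∑[ x′ ∈ G′ ] ∑[ j ∈ interval 0 blocks ] sumL (interval (block-start j) b₀) (χ x′) + ∑[ x′ ∈ G′ ] b₀
        ≡⟨ cong₂ _+_ (sum-swap G′ (interval 0 blocks) _) (trans (sum-const G′ b₀) (cong (_* b₀) (length-grid k n′))) ⟩
      ∑[ j ∈ interval 0 blocks ] mass j + N′ * b₀ ∎
      where open ≤-Reasoning

    1≤blocks : 1 ≤ blocks
    1≤blocks = m≥n⇒m/n>0 (*-cancelˡ-≤ d {{>-nonZero (≤-trans 1≤a a≤d)}} (begin
      d * b₀      ≤⟨ m≤n*m (d * b₀) 2 ⟩
      2 * (d * b₀) ≡⟨ *-assoc 2 d b₀ ⟨
      2 * d * b₀  ≤⟨ 2db≤an ⟩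
      a * n₀      ≤⟨ *-monoˡ-≤ n₀ a≤d ⟩
      d * n₀      ∎))
      where open ≤-Reasoning

    -- Averaging over the blocks: D has relative density at least ε/2 in
    -- some block of first coordinates.
    densest-block : Σ[ j ∈ ℕ ] j < blocks × a * b₀ * N′ ≤ 2 * d * mass j
    densest-block
      with j , j∈ , ∑≤ ← sum≤length*max (interval 0 blocks) mass (subst (1 ≤_) (sym (length-interval 0 blocks)) 1≤blocks)
      = j , proj₂ (∈-interval⁻ j∈) , *-cancelˡ-≤ blocks {{>-nonZero 1≤blocks}} (begin
        blocks * (a * b₀ * N′)    ≡⟨ reassoc blocks a b₀ N′ ⟩
        a * (blocks * b₀) * N′    ≤⟨ *-monoˡ-≤ N′ (*-monoʳ-≤ a (m/n*n≤m n₀ b₀)) ⟩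
        a * n₀ * N′               ≤⟨ half-in-blocks ⟩
        2 * d * S                 ≤⟨ *-monoʳ-≤ (2 * d) (subst (λ l → S ≤ l * mass j) (length-interval 0 blocks) ∑≤) ⟩
        2 * d * (blocks * mass j) ≡⟨ x∙yz≈y∙xz (2 * d) blocks (mass j) ⟩
        blocks * (2 * d * mass j) ∎)
      where
      open ≤-Reasoning
      S = ∑[ j ∈ interval 0 blocks ] mass j
      X = a * n₀ * N′
      reassoc : ∀ q a b N → q * (a * b * N) ≡ a * (q * b) * N
      reassoc = solve-∀
      half-in-blocks : X ≤ 2 * d * S
      half-in-blocks = +-cancelʳ-≤ X X (2 * d * S) (begin
        X + X                            ≡⟨ double a n₀ N′ ⟩
        2 * (a * (n₀ * N′))              ≤⟨ *-monoʳ-≤ 2 (density⇒ ε≡a/d D-dense) ⟩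
        2 * (d * length D)               ≤⟨ *-monoʳ-≤ 2 (*-monoʳ-≤ d length≤∑mass) ⟩
        2 * (d * (S + N′ * b₀))          ≡⟨ distribute d S N′ b₀ ⟩
        2 * d * S + N′ * (2 * d * b₀)    ≤⟨ +-monoʳ-≤ (2 * d * S) (*-monoʳ-≤ N′ 2db≤an) ⟩
        2 * d * S + N′ * (a * n₀)        ≡⟨ cong (2 * d * S +_) (*-comm N′ (a * n₀)) ⟩
        2 * d * S + X                    ∎)
        where
        double : ∀ a n N → a * n * N + a * n * N ≡ 2 * (a * (n * N))
        double = solve-∀
        distribute : ∀ d S N b → 2 * (d * (S + N * b)) ≡ 2 * d * S + N * (2 * d * b)
        distribute = solve-∀

    j* : ℕ
    j* = proj₁ densest-block

    J-start : ℕ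
    J-start = block-start j*

    J : List ℕ
    J = interval J-start b₀

    fibre : Vec ℕ k → List ℕ
    fibre x′ = filter (λ x₀ → (x₀ ∷ x′) ∈? D) J

    ∈-fibre⁻ : ∀ {x′ x₀} → x₀ ∈ fibre x′ → InInterval J-start b₀ x₀ × (x₀ ∷ x′) ∈ D
    ∈-fibre⁻ x₀∈ with x₀∈J , x∈D ← ∈-filter⁻ (λ x₀ → (x₀ ∷ _) ∈? D) x₀∈ = ∈-interval⁻ x₀∈J , x∈D

    Heavy : Vec ℕ k → Set
    Heavy x′ = a * b₀ ≤ 4 * d * length (fibre x′)

    heavy? : ∀ x′ → Dec (Heavy x′)
    heavy? x′ = a * b₀ ≤? 4 * d * length (fibre x′)

    heavies : List (Vec ℕ k)
    heavies = filter heavy? G′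

    -- Markov's inequality for the fibre sizes in the densest block.
    many-heavy-fibres : a * N′ ≤ 4 * d * length heavies
    many-heavy-fibres = *-cancelˡ-≤ b₀ (subst₂ _≤_ (reassoc-l a b₀ N′) (reassoc-r d b₀ c)
      (+-cancelʳ-≤ Y Y (4 * d * b₀ * c) (begin
        Y + Y                                      ≡⟨ double Y ⟩
        2 * Y                                      ≤⟨ *-monoʳ-≤ 2 (proj₂ (proj₂ densest-block)) ⟩
        2 * (2 * d * mass j*)                      ≡⟨ quadruple d (mass j*) ⟩
        4 * d * mass j*                            ≡⟨ cong (4 * d *_) mass≡∑fibre ⟩
        4 * d * ∑[ x′ ∈ G′ ] length (fibre x′)     ≡⟨ sum-* G′ (4 * d) _ ⟨
        ∑[ x′ ∈ G′ ] (4 * d * length (fibre x′))   ≤⟨ sum≤cap*#above+threshold*length G′ _ (a * b₀) fibre≤ ⟩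
        4 * d * b₀ * c + a * b₀ * length G′        ≡⟨ cong (λ l → 4 * d * b₀ * c + a * b₀ * l) (length-grid k n′) ⟩
        4 * d * b₀ * c + Y                         ∎)))
      where
      open ≤-Reasoning
      c = length heavies
      Y = a * b₀ * N′
      mass≡∑fibre : mass j* ≡ ∑[ x′ ∈ G′ ] length (fibre x′)
      mass≡∑fibre = sum-cong G′ (λ x′ → sym (length-filter≡∑𝟙 (λ x₀ → (x₀ ∷ x′) ∈? D) J))
      fibre≤ : ∀ x′ → 4 * d * length (fibre x′) ≤ 4 * d * b₀
      fibre≤ x′ = *-monoʳ-≤ (4 * d) (≤-trans (length-filter _ J) (≤-reflexive (length-interval J-start b₀)))
      double : ∀ Y → Y + Y ≡ 2 * Y
      double = solve-∀
      quadruple : ∀ d M → 2 * (2 * d * M) ≡ 4 * d * M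
      quadruple = solve-∀
      reassoc-l : ∀ a b N → a * b * N ≡ b * (a * N)
      reassoc-l = solve-∀
      reassoc-r : ∀ d b c → 4 * d * b * c ≡ b * (4 * d * c)
      reassoc-r = solve-∀

    heavy⇒member : ∀ x′ → Heavy x′ → ContainsElem F₀ (fibre x′)
    heavy⇒member x′ heavy = good J-start b₀ (s≤s z≤n) ≤-refl (fibre x′)
      (AllPairs.filter⁺ _ (interval-increasing J-start b₀)) (All.tabulate (λ x₀∈ → proj₁ (∈-fibre⁻ x₀∈)))
      (quarter-density⇐ ε≡a/d heavy)

    -- Light fibres get the junk witness [], so that witness⊆fibre holds for every tail.
    witness-of : ∀ x′ → Dec (Heavy x′) → List ℕ
    witness-of x′ (yes heavy) = proj₁ (heavy⇒member x′ heavy)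
    witness-of x′ (no  _)     = []

    witness : Vec ℕ k → List ℕ
    witness x′ = witness-of x′ (heavy? x′)

    witness-member : ∀ x′ → Heavy x′ → mem F₀ (witness x′) × All (InInterval J-start b₀) (witness x′)
    witness-member x′ heavy = member (heavy? x′)
      where
      member : ∀ heavy? → mem F₀ (witness-of x′ heavy?) × All (InInterval J-start b₀) (witness-of x′ heavy?)
      member (no ¬heavy) = contradiction heavy ¬heavy
      member (yes heavy) = proj₁ (proj₂ (heavy⇒member x′ heavy)) ,
        All.map (λ x₀∈ → proj₁ (∈-fibre⁻ x₀∈)) (proj₂ (proj₂ (heavy⇒member x′ heavy)))

    witness⊆fibre : ∀ x′ → All (λ x₀ → (x₀ ∷ x′) ∈ D) (witness x′)
    witness⊆fibre x′ = ⊆fibre (heavy? x′)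
      where
      ⊆fibre : ∀ heavy? → All (λ x₀ → (x₀ ∷ x′) ∈ D) (witness-of x′ heavy?)
      ⊆fibre (no  _)     = []
      ⊆fibre (yes heavy) = All.map (λ x₀∈ → proj₂ (∈-fibre⁻ x₀∈)) (proj₂ (proj₂ (heavy⇒member x′ heavy)))

    witnesses : List (List ℕ)
    witnesses = deduplicate _≟ₗ_ (map witness heavies)

    ∈-witnesses⁻ : ∀ {w} → w ∈ map witness heavies → mem F₀ w × All (InInterval J-start b₀) w
    ∈-witnesses⁻ w∈ with x′ , x′∈ , refl ← ∈-map⁻ witness w∈ =
      witness-member x′ (proj₂ (∈-filter⁻ heavy? {xs = G′} x′∈))

    #witnesses≤m₀ : length witnesses ≤ m₀
    #witnesses≤m₀ = IsMaxCount⇒length≤ F₀ maxCount (s≤s z≤n) (deduplicate-! _≟ₗ_ (map witness heavies))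
      (All.tabulate (λ w∈ → ∈-witnesses⁻ (∈-deduplicate⁻ _≟ₗ_ (map witness heavies) w∈)))

    popular : Σ[ w ∈ List ℕ ] w ∈ map witness heavies ×
              length heavies ≤ length witnesses * length (filter (λ x′ → witness x′ ≟ₗ w) heavies)
    popular = pigeonhole _≟ₗ_ witness heavies (1≤m*n⇒1≤n (4 * d) (≤-trans (*-mono-≤ 1≤a 1≤N′) many-heavy-fibres))

    w* : List ℕ
    w* = proj₁ popular

    w*-member : mem F₀ w* × All (InInterval J-start b₀) w*
    w*-member = ∈-witnesses⁻ (proj₁ (proj₂ popular))

    Extends : Vec ℕ k → Set
    Extends x′ = All (λ x₀ → (x₀ ∷ x′) ∈ D) w*

    extends? : ∀ x′ → Dec (Extends x′)
    extends? x′ = All.all? (λ x₀ → (x₀ ∷ x′) ∈? D) w*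

    D′ : List (Vec ℕ k)
    D′ = filter extends? G′

    D′-unique : Unique D′
    D′-unique = Unique.filter⁺ extends? (grid-unique k n′)

    D′⊆grid : All (InGrid n′) D′
    D′⊆grid = All.tabulate (λ x′∈ → ∈-grid⁻ k n′ (proj₁ (∈-filter⁻ extends? {xs = G′} x′∈)))

    D′-dense : θ₂ ε m₀ ℚ.* ⟦ N′ ⟧ ℚ.≤ ⟦ length D′ ⟧
    D′-dense = θ₂-density⇐ ε≡a/d 1≤m (begin
      a * N′                                ≤⟨ many-heavy-fibres ⟩
      4 * d * length heavies                ≤⟨ *-monoʳ-≤ (4 * d) (proj₂ (proj₂ popular)) ⟩
      4 * d * (length witnesses * #popular) ≤⟨ *-monoʳ-≤ (4 * d) (*-mono-≤ #witnesses≤m₀ #popular≤#D′) ⟩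
      4 * d * (m₀ * length D′)              ≡⟨ *-assoc (4 * d) m₀ _ ⟨
      4 * d * m₀ * length D′                ∎)
      where
      open ≤-Reasoning
      #popular = length (filter (λ x′ → witness x′ ≟ₗ w*) heavies)
      #popular≤#D′ : #popular ≤ length D′
      #popular≤#D′ = Sublist.length-mono-≤ (Sublist.filter⁺ (λ x′ → witness x′ ≟ₗ w*) extends?
        (λ { refl w≡w* → subst (All _) w≡w* (witness⊆fibre _) }) (Sublist.filter-⊆ heavy? G′))

    J⊆[n₀] : ∀ {x₀} → InInterval J-start b₀ x₀ → In[ n₀ ] x₀
    J⊆[n₀] {x₀} (J-start≤x₀ , x₀<J-end) = ≤-trans (s≤s z≤n) J-start≤x₀ , ≤-pred (begin-strict
      x₀                  <⟨ x₀<J-end ⟩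
      1 + j* * b₀ + b₀    ≡⟨ cong suc (+-comm (j* * b₀) b₀) ⟩
      1 + suc j* * b₀     ≤⟨ s≤s (*-monoˡ-≤ b₀ (proj₁ (proj₂ densest-block))) ⟩
      1 + blocks * b₀     ≤⟨ s≤s (m/n*n≤m n₀ b₀) ⟩
      1 + n₀              ∎)
      where open ≤-Reasoning

    extend : HasBox (tail F) n′ D′ → HasBox F n D
    extend (I′ , I′-members , I′-box) = I , I-members , I-box
      where
      I : Fin (suc k) → List ℕ
      I zero    = w*
      I (suc p) = I′ p
      I-members : ∀ p → mem (F p) (I p) × All In[ n p ] (I p)
      I-members zero    = proj₁ w*-member , All.map J⊆[n₀] (proj₂ w*-member)
      I-members (suc p) = I′-members p
      I-box : ∀ x → (∀ p → lookup x p ∈ I p) → x ∈ D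
      I-box (x₀ ∷ x′) x∈I =
        All.lookup (proj₂ (∈-filter⁻ extends? {xs = G′} (I′-box x′ (λ p → x∈I (suc p))))) (x∈I zero)

  box-in-dense-set : ∀ k {ε F b m n} → 0ℚ ℚ.< ε → ε ℚ.≤ 1ℚ → Admissible k ε F b m n →
    ∀ {D} → Unique D → All (InGrid n) D → ε ℚ.* ⟦ product n ⟧ ℚ.≤ ⟦ length D ⟧ → HasBox F n D
  box-in-dense-set zero {ε} 0<ε _ _ {[]} _ _ ε*1≤0 =
    contradiction (ℚ.<-≤-trans 0<ε (ℚ.≤-trans (ℚ.≤-reflexive (sym (ℚ.*-identityʳ ε))) ε*1≤0)) (ℚ.<-irrefl refl)
  box-in-dense-set zero _ _ _ {[] ∷ _} _ _ _ = (λ ()) , (λ ()) , λ { [] _ → here refl }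
  box-in-dense-set (suc k) {ε} {F} {b} {m} {n} 0<ε ε≤1 (adm₁ , adm) D-unique D⊆grid D-dense =
    extend (box-in-dense-set k next-positive next≤1 adm D′-unique D′⊆grid D′-dense)
    where
    lb = levelBounds 0<ε ε≤1 adm₁
    open LevelBounds lb using (next-positive; next≤1)
    open Step {k} {ε} {F} {b} {m} {n} lb adm₁ (1≤product _ (Admissible⇒1≤n k next-positive next≤1 adm))
      D-unique D⊆grid D-dense

open import Defs
open import Data.Nat using (ℕ; suc)
open import Data.Integer using (+_; _≤_)
open import Data.Rational using (ℚ; 0ℚ; 1ℚ; _<_; _*_) renaming (_≤_ to _≤ℚ_)
open import Data.Fin using (Fin)
open import Data.Vec using (Vec; lookup)
open import Data.List using (List; length)
open import Data.List.Relation.Unary.All using (All)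
open import Data.List.Relation.Unary.AllPairs using (AllPairs)
open import Data.List.Membership.Propositional using (_∈_)
open import Data.Product using (Σ; _×_)
open import Relation.Binary.PropositionalEquality using (_≢_)

open Levels using (Chain⇒Admissible)
open Box using (box-in-dense-set)

lemma5p2 : (ε : ℚ) → 0ℚ < ε → ε ≤ℚ 1ℚ →
  (q : ℕ) (F : Fin (suc q) → Family) →
  (∀ p → UniformlyDensityRegular (F p)) →
  (ch : Chain q F ε) →
  (n : Fin (suc q) → ℕ) →
  (∀ p → Tval (Chain.e ch p) (Chain.b ch p) ≤ + (n p)) →
  (D : List (Vec ℕ (suc q))) → AllPairs _≢_ D →
  All (λ x → ∀ p → In[ n p ] (lookup x p)) D →
  ε * ⟦ product n ⟧ ≤ℚ ⟦ length D ⟧ →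
  Σ (Fin (suc q) → List ℕ) λ I →
    (∀ p → mem (F p) (I p) × All In[ n p ] (I p)) ×
    (∀ (x : Vec ℕ (suc q)) → (∀ p → lookup x p ∈ I p) → x ∈ D)
lemma5p2 ε 0<ε ε≤1 q F _ ch n long D D-unique D⊆grid D-dense =
  box-in-dense-set (suc q) {ε} {F} {Chain.b ch} {Chain.m ch} {n} 0<ε ε≤1 (Chain⇒Admissible ch n long)
    D-unique D⊆grid D-dense
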